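{- Let $\mathcal G$ be the infinite directed graph with vertex set $\{T_i, B_i : i\ge 0\}$ and the following edges: $T_i\to B_i$ for all $i\ge0$ (flat step); $B_i\to T_{i+1}$ for all $i\ge0$ (up step); $T_{i+1}\to T_i$ and $B_{i+1}\to B_i$ for all $i\ge0$ (down steps); and additionally $T_j\to T_0$ and $B_j\to B_0$ for all $j\ge2$ (catastrophes). For $i\ge0$ let $f_i(z)=\sum_{n\ge0} f_{i,n}z^n$ and $g_i(z)=\sum_{n\ge0} g_{i,n}z^n$, where $f_{i,n}$ (resp. $g_{i,n}$) is the number of directed walks of length $n$ (i.e. with $n$ edges) in $\mathcal G$ starting at $T_0$ and ending at $T_i$ (resp. $B_i$). Let $t=t(z)$ be the unique formal power series with $t(0)=0$ satisfying $t(1-t)^2=z^3$, i.e. $t=\sum_{n\ge1}\frac1n\binom{3n-2}{n-1}z^{3n}$. Then $$f_0=\frac{ -t+z-zt}{ -t+z-2zt+zt^2},\qquad g_0=\frac{z(z-t)}{ -t+z-2zt+zt^2}.$$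
   Context: Walks from $T_0$ to $T_0$ in $\mathcal G$ encode $S$-Motzkin paths with catastrophes: paths with steps up $(1,1)$, flat $(1,0)$, down $(1,-1)$ never going below the $x$-axis, in which, ignoring down steps, the steps alternate flat, up, flat, up, ..., starting with flat, and where additionally a catastrophe step may return the path from any level $j\ge 2$ directly to level $0$ (keeping the current phase of the flat/up alternation); $T_i$/$B_i$ record the current level $i$ and whether the next non-down step is flat ($T$) or up ($B$). All generating functions are formal power series in $z$. -}

module Defs where

open import Data.Nat using (ℕ; zero; suc; _∸_)
import Data.Nat as N
open import Data.Integer using (ℤ; _+_; _*_; -_; _-_; 0ℤ; 1ℤ)
open import Data.List using (List; []; _∷_; map; upTo)
open import Relation.Nullary using (yes; no)
open import Relation.Binary.PropositionalEquality using (_≡_)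

sumℤ : List ℤ → ℤ
sumℤ [] = 0ℤ
sumℤ (x ∷ xs) = x + sumℤ xs

data V : Set where
  T : ℕ → V
  B : ℕ → V

same : V → V → ℤ
same (T i) (T j) with i N.≟ j
... | yes _ = 1ℤ
... | no _ = 0ℤ
same (B i) (B j) with i N.≟ j
... | yes _ = 1ℤ
... | no _ = 0ℤ
same (T _) (B _) = 0ℤ
same (B _) (T _) = 0ℤ

-- out-neighbours (edge targets) of each vertex; each edge listed once
succs : V → List V
succs (T zero) = B zero ∷ []
succs (T (suc zero)) = B 1 ∷ T 0 ∷ []
succs (T (suc (suc j))) = B (suc (suc j)) ∷ T (suc j) ∷ T 0 ∷ []
succs (B zero) = T 1 ∷ []
succs (B (suc zero)) = T 2 ∷ B 0 ∷ []
succs (B (suc (suc j))) = T (suc (suc (suc j))) ∷ B (suc j) ∷ B 0 ∷ []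

walks : ℕ → V → V → ℤ
walks zero u w = same u w
walks (suc n) u w = sumℤ (map (λ s → walks n s w) (succs u))

Series : Set
Series = ℕ → ℤ

f : ℕ → Series
f i n = walks n (T 0) (T i)

g : ℕ → Series
g i n = walks n (T 0) (B i)

_⊕_ : Series → Series → Series
(a ⊕ b) n = a n + b n

⊖_ : Series → Series
(⊖ a) n = - a n

_⊛_ : Series → Series → Series
(a ⊛ b) n = sumℤ (map (λ k → a k * b (n ∸ k)) (upTo (suc n)))

infixl 6 _⊕_
infixl 7 _⊛_
infix 4 _≋_
infix 8 ⊖_

const : ℤ → Series
const c zero = c
const c (suc _) = 0ℤ

zS : Series
zS 1 = 1ℤ
zS _ = 0ℤ

oneS : Series
oneS = const 1ℤ

_≋_ : Series → Series → Set
a ≋ b = ∀ n → a n ≡ b n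

-- Fix the target w ∈ {T₀, B₀}. The generating functions of walks from each vertex u to w
-- form the unique solution of the infinite linear system X u = [u = w] + z Σ_{u → v} X v,
-- because multiplication by z shifts coefficients. Writing t = z³ q with q (1 - t)² = 1, a
-- solution scaled by a unit det is found explicitly: X (T i) = α + zⁱ cᵢ (i ≥ 1) and
-- X (B (i + 1)) = β + zⁱ (cᵢ₊₁ - cᵢ), where (1 - t)² cᵢ₊₂ = (2 - t) cᵢ₊₁ - cᵢ. This
-- recurrence is (y - 1)² = z³ y³ with the root y = 1/t divided out, so it solves the
-- equations at every level ≥ 2, and the five remaining boundary equations are linear in
-- α, β, a₀ = X T₀, b₀ = X B₀, c₁. Uniqueness gives det · f₀ = a₀; then a₀ · D = det · N
-- holds modulo t (1 - t)² = z³, and cancelling det yields f₀ · D = N (likewise for g₀).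
module Submission where

open import Defs
open import Data.Integer using (0ℤ)
open import Relation.Binary.PropositionalEquality using (_≡_)
open import Data.Product using (_×_)

open import Level using (0ℓ)
open import Data.Nat using (ℕ; zero; suc; _∸_)
open import Data.Fin using (zero; suc)
open import Data.Integer using (_+_; _*_; -_; 1ℤ)
import Data.Integer as ℤ
import Data.Integer.Properties as ℤ
open import Data.Integer.Tactic.RingSolver using (solve-∀)
open import Data.List using (List; []; _∷_; map; foldr; applyUpTo)
open import Data.List.Properties using (map-upTo; map-cong)
open import Data.Maybe using (Maybe; just; nothing)
open import Data.Product using (_,_)
open import Data.Vec using (Vec; []; _∷_; lookup)
open import Relation.Nullary using (yes; no)
open import Relation.Binary.PropositionalEquality
  using (refl; sym; trans; cong; cong₂; module ≡-Reasoning)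
open import Relation.Binary.Bundles using (Setoid)
open import Relation.Binary.Structures using (IsEquivalence)
import Relation.Binary.Reasoning.Setoid as SetoidReasoning
open import Algebra.Bundles using (CommutativeRing)
open import Algebra.Solver.Ring.AlmostCommutativeRing
  using (_-Raw-AlmostCommutative⟶_; fromCommutativeRing)
import Algebra.Solver.Ring

-- The ring of formal power series

≋-refl : ∀ {a} → a ≋ a
≋-refl n = refl

≋-sym : ∀ {a b} → a ≋ b → b ≋ a
≋-sym p n = sym (p n)

≋-trans : ∀ {a b c} → a ≋ b → b ≋ c → a ≋ c
≋-trans p q n = trans (p n) (q n)

≋-isEquivalence : IsEquivalence _≋_
≋-isEquivalence = record { refl = ≋-refl ; sym = ≋-sym ; trans = ≋-trans }

≋-setoid : Setoid 0ℓ 0ℓ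
≋-setoid = record { isEquivalence = ≋-isEquivalence }

module ≋-Reasoning = SetoidReasoning ≋-setoid

const-zero : ∀ n → const 0ℤ n ≡ 0ℤ
const-zero zero    = refl
const-zero (suc n) = refl

⊕-cong : ∀ {a a′ b b′} → a ≋ a′ → b ≋ b′ → a ⊕ b ≋ a′ ⊕ b′
⊕-cong p q n = cong₂ _+_ (p n) (q n)

infix 8 ↑_
↑_ : Series → Series
(↑ a) n = a (suc n)

-- Recursive in the first factor, so that the ring laws of ⊛ can be proved by induction.
infixl 7 _·_
_·_ : Series → Series → Series
(a · b) zero    = a 0 * b 0
(a · b) (suc n) = a 0 * b (suc n) + (↑ a · b) n

⊛≋· : ∀ a b → a ⊛ b ≋ a · b
⊛≋· a b n = trans (cong sumℤ (map-upTo (λ k → a k * b (n ∸ k)) (suc n))) (convolution a n)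
  where
  convolution : ∀ a n → sumℤ (applyUpTo (λ k → a k * b (n ∸ k)) (suc n)) ≡ (a · b) n
  convolution a zero    = ℤ.+-identityʳ _
  convolution a (suc n) = cong (λ r → a 0 * b (suc n) + r) (convolution (↑ a) n)

·-cong : ∀ {a a′ b b′} → a ≋ a′ → b ≋ b′ → a · b ≋ a′ · b′
·-cong p q zero    = cong₂ _*_ (p 0) (q 0)
·-cong p q (suc n) = cong₂ _+_ (cong₂ _*_ (p 0) (q (suc n))) (·-cong (λ k → p (suc k)) q n)

·-zeroˡ : ∀ a b → (∀ k → a k ≡ 0ℤ) → ∀ n → (a · b) n ≡ 0ℤ
·-zeroˡ a b a≡0 zero    rewrite a≡0 0 = refl
·-zeroˡ a b a≡0 (suc n) rewrite a≡0 0 | ·-zeroˡ (↑ a) b (λ k → a≡0 (suc k)) n = refl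

·-identityˡ : ∀ a → oneS · a ≋ a
·-identityˡ a zero    = ℤ.*-identityˡ (a 0)
·-identityˡ a (suc n) rewrite ·-zeroˡ (↑ oneS) a (λ _ → refl) n =
  trans (ℤ.+-identityʳ (1ℤ * a (suc n))) (ℤ.*-identityˡ (a (suc n)))

·-distribʳ : ∀ a b c → (a ⊕ b) · c ≋ a · c ⊕ b · c
·-distribʳ a b c zero    = ℤ.*-distribʳ-+ (c 0) (a 0) (b 0)
·-distribʳ a b c (suc n) rewrite ·-distribʳ (↑ a) (↑ b) c n =
  regroup (a 0) (b 0) (c (suc n)) ((↑ a · c) n) ((↑ b · c) n)
  where
  regroup : ∀ x y w p q → (x + y) * w + (p + q) ≡ (x * w + p) + (y * w + q)
  regroup = solve-∀

·-scaleˡ : ∀ c a b → (λ k → c * a k) · b ≋ λ k → c * (a · b) k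
·-scaleˡ c a b zero    = ℤ.*-assoc c (a 0) (b 0)
·-scaleˡ c a b (suc n) rewrite ·-scaleˡ c (↑ a) b n = regroup c (a 0) (b (suc n)) ((↑ a · b) n)
  where
  regroup : ∀ c x y p → c * x * y + c * p ≡ c * (x * y + p)
  regroup = solve-∀

·-assoc : ∀ a b c → (a · b) · c ≋ a · (b · c)
·-assoc a b c zero    = ℤ.*-assoc (a 0) (b 0) (c 0)
·-assoc a b c (suc n)
  rewrite ·-distribʳ (λ k → a 0 * b (suc k)) (↑ a · b) c n
        | ·-scaleˡ (a 0) (↑ b) c n
        | ·-assoc (↑ a) b c n
        = regroup (a 0) (b 0) (c (suc n)) ((↑ b · c) n) ((↑ a · (b · c)) n)
  where
  regroup : ∀ x y w p r → x * y * w + (x * p + r) ≡ x * (y * w + p) + r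
  regroup = solve-∀

·-expandʳ : ∀ a b n → (a · b) (suc n) ≡ (a · ↑ b) n + a (suc n) * b 0
·-expandʳ a b zero    = refl
·-expandʳ a b (suc n) rewrite ·-expandʳ (↑ a) b n =
  sym (ℤ.+-assoc (a 0 * b (suc (suc n))) ((↑ a · ↑ b) n) (a (suc (suc n)) * b 0))

·-comm : ∀ a b → a · b ≋ b · a
·-comm a b zero    = ℤ.*-comm (a 0) (b 0)
·-comm a b (suc n) = begin
  a 0 * b (suc n) + (↑ a · b) n  ≡⟨ cong (λ r → a 0 * b (suc n) + r) (·-comm (↑ a) b n) ⟩
  a 0 * b (suc n) + (b · ↑ a) n  ≡⟨ ℤ.+-comm (a 0 * b (suc n)) ((b · ↑ a) n) ⟩
  (b · ↑ a) n + a 0 * b (suc n)  ≡⟨ cong (λ r → (b · ↑ a) n + r) (ℤ.*-comm (a 0) (b (suc n))) ⟩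
  (b · ↑ a) n + b (suc n) * a 0  ≡⟨ sym (·-expandʳ b a n) ⟩
  (b · a) (suc n)                ∎
  where open ≡-Reasoning

⊛-cong : ∀ {a a′ b b′} → a ≋ a′ → b ≋ b′ → a ⊛ b ≋ a′ ⊛ b′
⊛-cong {a} {a′} {b} {b′} p q = ≋-trans (⊛≋· a b) (≋-trans (·-cong p q) (≋-sym (⊛≋· a′ b′)))

⊛-comm : ∀ a b → a ⊛ b ≋ b ⊛ a
⊛-comm a b = ≋-trans (⊛≋· a b) (≋-trans (·-comm a b) (≋-sym (⊛≋· b a)))

⊛-assoc : ∀ a b c → (a ⊛ b) ⊛ c ≋ a ⊛ (b ⊛ c)
⊛-assoc a b c = begin
  (a ⊛ b) ⊛ c  ≈⟨ ⊛≋· (a ⊛ b) c ⟩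
  (a ⊛ b) · c  ≈⟨ ·-cong (⊛≋· a b) ≋-refl ⟩
  (a · b) · c  ≈⟨ ·-assoc a b c ⟩
  a · (b · c)  ≈⟨ ·-cong ≋-refl (≋-sym (⊛≋· b c)) ⟩
  a · (b ⊛ c)  ≈⟨ ≋-sym (⊛≋· a (b ⊛ c)) ⟩
  a ⊛ (b ⊛ c)  ∎
  where open ≋-Reasoning

⊛-identityˡ : ∀ a → oneS ⊛ a ≋ a
⊛-identityˡ a = ≋-trans (⊛≋· oneS a) (·-identityˡ a)

⊛-distribʳ : ∀ c a b → (a ⊕ b) ⊛ c ≋ a ⊛ c ⊕ b ⊛ c
⊛-distribʳ c a b = ≋-trans (⊛≋· (a ⊕ b) c)
  (≋-trans (·-distribʳ a b c) (⊕-cong (≋-sym (⊛≋· a c)) (≋-sym (⊛≋· b c))))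

⊛-distribˡ : ∀ c a b → c ⊛ (a ⊕ b) ≋ c ⊛ a ⊕ c ⊛ b
⊛-distribˡ c a b = ≋-trans (⊛-comm c (a ⊕ b))
  (≋-trans (⊛-distribʳ c a b) (⊕-cong (⊛-comm a c) (⊛-comm b c)))

seriesRing : CommutativeRing 0ℓ 0ℓ
seriesRing = record
  { Carrier = Series ; _≈_ = _≋_ ; _+_ = _⊕_ ; _*_ = _⊛_ ; -_ = ⊖_ ; 0# = const 0ℤ ; 1# = oneS
  ; isCommutativeRing = record
    { isRing = record
      { +-isAbelianGroup = record
        { isGroup = record
          { isMonoid = record
            { isSemigroup = record
              { isMagma = record { isEquivalence = ≋-isEquivalence ; ∙-cong = ⊕-cong }
              ; assoc = λ a b c n → ℤ.+-assoc (a n) (b n) (c n) }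
            ; identity = (λ a n → trans (cong (_+ a n) (const-zero n)) (ℤ.+-identityˡ (a n)))
                       , (λ a n → trans (cong (a n +_) (const-zero n)) (ℤ.+-identityʳ (a n))) }
          ; inverse = (λ a n → trans (ℤ.+-inverseˡ (a n)) (sym (const-zero n)))
                    , (λ a n → trans (ℤ.+-inverseʳ (a n)) (sym (const-zero n)))
          ; ⁻¹-cong = λ p n → cong -_ (p n) }
        ; comm = λ a b n → ℤ.+-comm (a n) (b n) }
      ; *-cong = ⊛-cong
      ; *-assoc = ⊛-assoc
      ; *-identity = ⊛-identityˡ , (λ a → ≋-trans (⊛-comm a oneS) (⊛-identityˡ a))
      ; distrib = ⊛-distribˡ , ⊛-distribʳ }
    ; *-comm = ⊛-comm } }

module R = CommutativeRing seriesRing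

const-* : ∀ a b → const (a * b) ≋ const a ⊛ const b
const-* a b n = trans (coefficient n) (sym (⊛≋· (const a) (const b) n))
  where
  coefficient : ∀ n → const (a * b) n ≡ (const a · const b) n
  coefficient zero    = refl
  coefficient (suc n) = sym (begin
    a * 0ℤ + (↑ const a · const b) n  ≡⟨ cong (_+ (↑ const a · const b) n) (ℤ.*-zeroʳ a) ⟩
    0ℤ + (↑ const a · const b) n      ≡⟨ ℤ.+-identityˡ _ ⟩
    (↑ const a · const b) n           ≡⟨ ·-zeroˡ (↑ const a) (const b) (λ _ → refl) n ⟩
    0ℤ                                ∎)
    where open ≡-Reasoning

const-homomorphism : ℤ.+-*-rawRing -Raw-AlmostCommutative⟶ fromCommutativeRing seriesRing
const-homomorphism = record
  { ⟦_⟧    = const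
  ; +-homo = λ a b → λ { zero → refl ; (suc n) → refl }
  ; *-homo = const-*
  ; -‿homo = λ a → λ { zero → refl ; (suc n) → refl }
  ; 0-homo = λ { zero → refl ; (suc n) → refl }
  ; 1-homo = λ { zero → refl ; (suc n) → refl } }

const-≟ : ∀ a b → Maybe (const a ≋ const b)
const-≟ a b with a ℤ.≟ b
... | yes refl = just ≋-refl
... | no _     = nothing

module SeriesSolver =
  Algebra.Solver.Ring ℤ.+-*-rawRing (fromCommutativeRing seriesRing) const-homomorphism const-≟
open SeriesSolver using (Polynomial; op; [+]; [*]; con; var; _:^_; :-_; _:+_; _:*_; _:-_;
                         ⟦_⟧; _:=_; solve; prove)

≋-modulo : ∀ {p r x y} k → p ≋ r ⊕ k ⊛ (x ⊕ ⊖ y) → x ≋ y → p ≋ r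
≋-modulo {p} {r} {x} {y} k p≋ x≋y n = begin
  p n                       ≡⟨ p≋ n ⟩
  r n + (k ⊛ (x ⊕ ⊖ y)) n   ≡⟨ cong (r n +_) (⊛-cong {k} {k} {x ⊕ ⊖ y} ≋-refl x-y≋0 n) ⟩
  r n + (k ⊛ const 0ℤ) n    ≡⟨ cong (r n +_) (trans (R.zeroʳ k n) (const-zero n)) ⟩
  r n + 0ℤ                  ≡⟨ ℤ.+-identityʳ (r n) ⟩
  r n                       ∎
  where
  open ≡-Reasoning
  x-y≋0 : x ⊕ ⊖ y ≋ const 0ℤ
  x-y≋0 n = trans (cong (λ v → v + - y n) (x≋y n)) (trans (ℤ.+-inverseʳ (y n)) (sym (const-zero n)))

-- Constant terms, multiplication by z, and units

⊛-coeff₀ : ∀ a b → (a ⊛ b) 0 ≡ a 0 * b 0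
⊛-coeff₀ a b = ⊛≋· a b 0

⟦⟧-coeff₀ : ∀ {n} (p : Polynomial n) (ρ ρ′ : Vec Series n) →
            (∀ i → lookup ρ i 0 ≡ lookup ρ′ i 0) → ⟦ p ⟧ ρ 0 ≡ ⟦ p ⟧ ρ′ 0
⟦⟧-coeff₀ (op [+] p p′) ρ ρ′ h = cong₂ _+_ (⟦⟧-coeff₀ p ρ ρ′ h) (⟦⟧-coeff₀ p′ ρ ρ′ h)
⟦⟧-coeff₀ (op [*] p p′) ρ ρ′ h = trans (⊛-coeff₀ (⟦ p ⟧ ρ) (⟦ p′ ⟧ ρ))
  (trans (cong₂ _*_ (⟦⟧-coeff₀ p ρ ρ′ h) (⟦⟧-coeff₀ p′ ρ ρ′ h)) (sym (⊛-coeff₀ (⟦ p ⟧ ρ′) (⟦ p′ ⟧ ρ′))))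
⟦⟧-coeff₀ (con c)       ρ ρ′ h = refl
⟦⟧-coeff₀ (var i)       ρ ρ′ h = h i
⟦⟧-coeff₀ (p :^ k)      ρ ρ′ h = power k
  where
  power : ∀ k → ⟦ p :^ k ⟧ ρ 0 ≡ ⟦ p :^ k ⟧ ρ′ 0
  power zero    = refl
  power (suc k) = trans (⊛-coeff₀ (⟦ p ⟧ ρ) (⟦ p :^ k ⟧ ρ))
    (trans (cong₂ _*_ (⟦⟧-coeff₀ p ρ ρ′ h) (power k)) (sym (⊛-coeff₀ (⟦ p ⟧ ρ′) (⟦ p :^ k ⟧ ρ′))))
⟦⟧-coeff₀ (:- p)        ρ ρ′ h = cong -_ (⟦⟧-coeff₀ p ρ ρ′ h)

z⊛-coeff₀ : ∀ a → (zS ⊛ a) 0 ≡ 0ℤ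
z⊛-coeff₀ a = trans (⊛-coeff₀ zS a) (ℤ.*-zeroˡ (a 0))

z⊛-coeffₛ : ∀ a n → (zS ⊛ a) (suc n) ≡ a n
z⊛-coeffₛ a n = begin
  (zS ⊛ a) (suc n)              ≡⟨ ⊛≋· zS a (suc n) ⟩
  0ℤ * a (suc n) + (↑ zS · a) n ≡⟨ cong (_+ (↑ zS · a) n) (ℤ.*-zeroˡ (a (suc n))) ⟩
  0ℤ + (↑ zS · a) n             ≡⟨ ℤ.+-identityˡ _ ⟩
  (↑ zS · a) n                  ≡⟨ ·-cong ↑zS≋1 ≋-refl n ⟩
  (oneS · a) n                  ≡⟨ ·-identityˡ a n ⟩
  a n                           ∎
  where
  open ≡-Reasoning
  ↑zS≋1 : ↑ zS ≋ oneS
  ↑zS≋1 zero    = refl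
  ↑zS≋1 (suc k) = refl

z⊛-cancel : ∀ a b → zS ⊛ a ≋ zS ⊛ b → a ≋ b
z⊛-cancel a b p n = trans (sym (z⊛-coeffₛ a n)) (trans (p (suc n)) (z⊛-coeffₛ b n))

↑-factor : ∀ a → a 0 ≡ 0ℤ → a ≋ zS ⊛ ↑ a
↑-factor a a₀ zero    = trans a₀ (sym (z⊛-coeff₀ (↑ a)))
↑-factor a a₀ (suc n) = sym (z⊛-coeffₛ (↑ a) n)

divide-by-z : ∀ s m r → s 0 ≡ 0ℤ → s ⊛ m ≋ zS ⊛ r → ↑ s ⊛ m ≋ r
divide-by-z s m r s₀ sm≋zr = z⊛-cancel (↑ s ⊛ m) r (begin
  zS ⊛ (↑ s ⊛ m)  ≈⟨ R.sym (R.*-assoc zS (↑ s) m) ⟩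
  zS ⊛ ↑ s ⊛ m    ≈⟨ R.*-congʳ {m} {zS ⊛ ↑ s} {s} (R.sym (↑-factor s s₀)) ⟩
  s ⊛ m           ≈⟨ sm≋zr ⟩
  zS ⊛ r          ∎)
  where open ≋-Reasoning

unit-coeff₀ : ∀ {m a r} → m 0 ≡ 1ℤ → a ⊛ m ≋ r → a 0 ≡ r 0
unit-coeff₀ {m} {a} {r} m₀ p = begin
  a 0        ≡⟨ sym (ℤ.*-identityʳ (a 0)) ⟩
  a 0 * 1ℤ   ≡⟨ cong (a 0 *_) (sym m₀) ⟩
  a 0 * m 0  ≡⟨ sym (⊛-coeff₀ a m) ⟩
  (a ⊛ m) 0  ≡⟨ p 0 ⟩
  r 0        ∎
  where open ≡-Reasoning

unit-annihilates : ∀ m d → m 0 ≡ 1ℤ → d ⊛ m ≋ const 0ℤ → ∀ n → d n ≡ 0ℤ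
unit-annihilates m d m₀ dm≋0 zero    = unit-coeff₀ {m} {d} m₀ dm≋0
unit-annihilates m d m₀ dm≋0 (suc n) = unit-annihilates m (↑ d) m₀
  (divide-by-z d m (const 0ℤ) (unit-annihilates m d m₀ dm≋0 0) (≋-trans dm≋0 (R.sym (R.zeroʳ zS)))) n

unit-cancel : ∀ m a b → m 0 ≡ 1ℤ → m ⊛ a ≋ m ⊛ b → a ≋ b
unit-cancel m a b m₀ ma≋mb n =
  ℤ.i-j≡0⇒i≡j (a n) (b n) (unit-annihilates m (a ⊕ ⊖ b) m₀ (≋-modulo oneS difference ma≋mb) n)
  where
  difference : (a ⊕ ⊖ b) ⊛ m ≋ const 0ℤ ⊕ oneS ⊛ (m ⊛ a ⊕ ⊖ (m ⊛ b))
  difference = solve 3 (λ a b m → (a :- b) :* m := con 0ℤ :+ con 1ℤ :* (m :* a :- m :* b)) ≋-refl a b m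

solve-for : ∀ m x a d n → m 0 ≡ 1ℤ → m ⊛ x ≋ a → a ⊛ d ≋ m ⊛ n → x ⊛ d ≋ n
solve-for m x a d n m₀ mx≋a ad≋mn = unit-cancel m (x ⊛ d) n m₀ (begin
  m ⊛ (x ⊛ d)  ≈⟨ R.sym (R.*-assoc m x d) ⟩
  m ⊛ x ⊛ d    ≈⟨ R.*-congʳ {d} {m ⊛ x} {a} mx≋a ⟩
  a ⊛ d        ≈⟨ ad≋mn ⟩
  m ⊛ n        ∎)
  where open ≋-Reasoning

module CubeFactor (t : Series) (t₀ : t 0 ≡ 0ℤ)
  (rel : t ⊛ (oneS ⊕ ⊖ t) ⊛ (oneS ⊕ ⊖ t) ≋ zS ⊛ zS ⊛ zS) where

  private
    u m : Series
    u = oneS ⊕ ⊖ t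
    m = u ⊛ u

    m₀ : m 0 ≡ 1ℤ
    m₀ = trans (⊛-coeff₀ u u) (cong (λ x → (1ℤ + - x) * (1ℤ + - x)) t₀)

    ↑t⊛m≋z² : ↑ t ⊛ m ≋ zS ⊛ zS
    ↑t⊛m≋z² = divide-by-z t m (zS ⊛ zS) t₀
      (≋-trans (R.sym (R.*-assoc t u u)) (≋-trans rel (R.*-assoc zS zS zS)))

    ↑t₀ : (↑ t) 0 ≡ 0ℤ
    ↑t₀ = trans (unit-coeff₀ {m} {↑ t} m₀ ↑t⊛m≋z²) (z⊛-coeff₀ zS)

    ↑↑t⊛m≋z : ↑ ↑ t ⊛ m ≋ zS
    ↑↑t⊛m≋z = divide-by-z (↑ t) m zS ↑t₀ ↑t⊛m≋z²

    ↑↑t₀ : (↑ ↑ t) 0 ≡ 0ℤ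
    ↑↑t₀ = unit-coeff₀ {m} {↑ ↑ t} m₀ ↑↑t⊛m≋z

  q : Series
  q = ↑ ↑ ↑ t

  qu²≋1 : q ⊛ (oneS ⊕ ⊖ t) ⊛ (oneS ⊕ ⊖ t) ≋ oneS
  qu²≋1 = ≋-trans (R.*-assoc q u u)
    (divide-by-z (↑ ↑ t) m oneS ↑↑t₀ (≋-trans ↑↑t⊛m≋z (R.sym (R.*-identityʳ zS))))

  z³q≋t : zS ⊛ zS ⊛ zS ⊛ q ≋ t
  z³q≋t = R.sym (begin
    t                           ≈⟨ ↑-factor t t₀ ⟩
    zS ⊛ ↑ t                    ≈⟨ R.*-congˡ {zS} (↑-factor (↑ t) ↑t₀) ⟩
    zS ⊛ (zS ⊛ ↑ ↑ t)           ≈⟨ R.*-congˡ {zS} (R.*-congˡ {zS} (↑-factor (↑ ↑ t) ↑↑t₀)) ⟩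
    zS ⊛ (zS ⊛ (zS ⊛ q))        ≈⟨ solve 2 (λ z q → z :* (z :* (z :* q)) := z :* z :* z :* q) ≋-refl zS q ⟩
    zS ⊛ zS ⊛ zS ⊛ q            ∎)
    where open ≋-Reasoning

-- Linear systems contracted by z

sumS : List Series → Series
sumS = foldr _⊕_ (const 0ℤ)

sumS-coeff : ∀ {A : Set} (X : A → Series) l n → sumS (map X l) n ≡ sumℤ (map (λ s → X s n) l)
sumS-coeff X []      n = const-zero n
sumS-coeff X (s ∷ l) n = cong (X s n +_) (sumS-coeff X l n)

⊛-sumS : ∀ {A : Set} m (X : A → Series) l → m ⊛ sumS (map X l) ≋ sumS (map (λ s → m ⊛ X s) l)
⊛-sumS m X []      = R.zeroʳ m
⊛-sumS m X (s ∷ l) =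
  ≋-trans (⊛-distribˡ m (X s) (sumS (map X l))) (⊕-cong (≋-refl {m ⊛ X s}) (⊛-sumS m X l))

module LinearSystem {V : Set} (next : V → List V) where

  record Solves (c X : V → Series) : Set where
    constructor solves
    field equation : ∀ u → X u ≋ c u ⊕ zS ⊛ sumS (map X (next u))
  open Solves public

  Solves-coeff₀ : ∀ {c X} → Solves c X → ∀ u → X u 0 ≡ c u 0
  Solves-coeff₀ {c} {X} sol u = begin
    X u 0                                   ≡⟨ equation sol u 0 ⟩
    c u 0 + (zS ⊛ sumS (map X (next u))) 0  ≡⟨ cong (c u 0 +_) (z⊛-coeff₀ (sumS (map X (next u)))) ⟩
    c u 0 + 0ℤ                              ≡⟨ ℤ.+-identityʳ (c u 0) ⟩
    c u 0                                   ∎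
    where open ≡-Reasoning

  Solves-coeffₛ : ∀ {c X} → Solves c X →
                  ∀ u n → X u (suc n) ≡ c u (suc n) + sumℤ (map (λ s → X s n) (next u))
  Solves-coeffₛ {c} {X} sol u n = trans (equation sol u (suc n))
    (cong (c u (suc n) +_) (trans (z⊛-coeffₛ (sumS (map X (next u))) n) (sumS-coeff X (next u) n)))

  solution-unique : ∀ {c X Y} → Solves c X → Solves c Y → ∀ n u → X u n ≡ Y u n
  solution-unique solX solY zero    u = trans (Solves-coeff₀ solX u) (sym (Solves-coeff₀ solY u))
  solution-unique {c} solX solY (suc n) u = begin
    _  ≡⟨ Solves-coeffₛ solX u n ⟩
    _  ≡⟨ cong (λ s → c u (suc n) + sumℤ s) (map-cong (λ v → solution-unique solX solY n v) (next u)) ⟩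
    _  ≡⟨ sym (Solves-coeffₛ solY u n) ⟩
    _  ∎
    where open ≡-Reasoning

  Solves-scale : ∀ m {c X} → Solves c X → Solves (λ u → m ⊛ c u) (λ u → m ⊛ X u)
  Solves-scale m {c} {X} sol = solves λ u → begin
    m ⊛ X u                                        ≈⟨ R.*-congˡ {m} {X u} (equation sol u) ⟩
    m ⊛ (c u ⊕ zS ⊛ sumS (map X (next u)))         ≈⟨ regroup (c u) (sumS (map X (next u))) ⟩
    m ⊛ c u ⊕ zS ⊛ (m ⊛ sumS (map X (next u)))     ≈⟨ R.+-congˡ {m ⊛ c u} (R.*-congˡ {zS} (⊛-sumS m X (next u))) ⟩
    m ⊛ c u ⊕ zS ⊛ sumS (map (λ s → m ⊛ X s) (next u)) ∎
    where
    open ≋-Reasoning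
    regroup : ∀ c s → m ⊛ (c ⊕ zS ⊛ s) ≋ m ⊛ c ⊕ zS ⊛ (m ⊛ s)
    regroup c s = solve 4 (λ m c s z → m :* (c :+ z :* s) := m :* c :+ z :* (m :* s)) ≋-refl m c s zS

open LinearSystem succs

-- Walks in 𝒢 and an explicit solution of their system

walkGF : V → V → Series
walkGF w u n = walks n u w

walkGF-solves : ∀ w → Solves (λ u → const (same u w)) (walkGF w)
walkGF-solves w = solves λ u → λ
  { zero    → sym (trans (cong (same u w +_) (z⊛-coeff₀ (sumS (map (walkGF w) (succs u)))))
                         (ℤ.+-identityʳ (same u w)))
  ; (suc n) → sym (trans (ℤ.+-identityˡ _)
                         (trans (z⊛-coeffₛ (sumS (map (walkGF w) (succs u))) n)
                                (sumS-coeff (walkGF w) (succs u) n))) }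

scaled-walkGF-unique : ∀ w m {X} → Solves (λ u → m ⊛ const (same u w)) X → ∀ u → m ⊛ walkGF w u ≋ X u
scaled-walkGF-unique w m solX u n = solution-unique (Solves-scale m (walkGF-solves w)) solX n u

data Base : V → Set where
  T₀ : Base (T 0)
  B₀ : Base (B 0)

same-T-off-base : ∀ {w} → Base w → ∀ i → same (T (suc i)) w ≡ 0ℤ
same-T-off-base T₀ i = refl
same-T-off-base B₀ i = refl

same-B-off-base : ∀ {w} → Base w → ∀ i → same (B (suc i)) w ≡ 0ℤ
same-B-off-base T₀ i = refl
same-B-off-base B₀ i = refl

zS^ : ℕ → Series
zS^ zero    = oneS
zS^ (suc n) = zS ⊛ zS^ n

module Ansatz (t q : Series)
  (z³q≋t : zS ⊛ zS ⊛ zS ⊛ q ≋ t) (qu²≋1 : q ⊛ (oneS ⊕ ⊖ t) ⊛ (oneS ⊕ ⊖ t) ≋ oneS)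
  {w : V} (base : Base w) (M α β a₀ b₀ c₁ : Series)
  (hα  : α ≋ zS ⊛ (α ⊕ β ⊕ a₀))
  (hβ  : β ≋ zS ⊛ (α ⊕ β ⊕ b₀))
  (hT₀ : a₀ ≋ M ⊛ const (same (T 0) w) ⊕ zS ⊛ b₀)
  (hB₀ : b₀ ≋ M ⊛ const (same (B 0) w) ⊕ zS ⊛ (α ⊕ zS ⊛ c₁))
  (hB₁ : (oneS ⊕ ⊖ t) ⊛ (oneS ⊕ ⊖ t) ⊛ c₁ ⊕ zS ⊛ β ≋ ⊖ ((oneS ⊕ ⊖ t) ⊛ α))
  where

  -- c₀ = - α is what the equation at T₁ forces.
  c : ℕ → Series
  c zero          = ⊖ α
  c (suc zero)    = c₁
  c (suc (suc j)) = q ⊛ ((oneS ⊕ oneS ⊕ ⊖ t) ⊛ c (suc j) ⊕ ⊖ c j)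

  c-recurrence : ∀ j → zS ⊛ zS ⊛ zS ⊛ c (suc (suc (suc j))) ≋
                       c (suc (suc j)) ⊕ ⊖ (oneS ⊕ oneS) ⊛ c (suc j) ⊕ c j
  c-recurrence j = ≋-modulo (⊖ e′) (≋-modulo e identity z³q≋t) qu²≋1
    where
    e e′ : Series
    e  = (oneS ⊕ oneS ⊕ ⊖ t) ⊛ c (suc (suc j)) ⊕ ⊖ c (suc j)
    e′ = (oneS ⊕ oneS ⊕ ⊖ t) ⊛ c (suc j) ⊕ ⊖ c j
    identity = solve 5 (λ z t q d₀ d₁ →
        let one = con 1ℤ
            two = one :+ one
            d₂  = q :* ((two :- t) :* d₁ :- d₀)
            d₃  = q :* ((two :- t) :* d₂ :- d₁)
        in z :* z :* z :* d₃
           := d₂ :+ :- two :* d₁ :+ d₀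
              :+ :- ((two :- t) :* d₁ :- d₀) :* (q :* (one :- t) :* (one :- t) :- one)
              :+ ((two :- t) :* d₂ :- d₁) :* (z :* z :* z :* q :- t))
      ≋-refl zS t q (c j) (c (suc j))

  X : V → Series
  X (T zero)    = a₀
  X (T (suc i)) = α ⊕ zS^ (suc i) ⊛ c (suc i)
  X (B zero)    = b₀
  X (B (suc i)) = β ⊕ zS^ i ⊛ (c (suc i) ⊕ ⊖ c i)

  Equation-at : V → Set
  Equation-at v = X v ≋ M ⊛ const (same v w) ⊕ zS ⊛ sumS (map X (succs v))

  equation-T₀ : Equation-at (T 0)
  equation-T₀ = ≋-trans hT₀
    (solve 4 (λ z m κ b → m :* κ :+ z :* b := m :* κ :+ z :* (b :+ con 0ℤ))
      ≋-refl zS M (const (same (T 0) w)) b₀)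

  equation-B₀ : Equation-at (B 0)
  equation-B₀ = ≋-trans hB₀
    (solve 5 (λ z m κ a c → m :* κ :+ z :* (a :+ z :* c) := m :* κ :+ z :* (a :+ z :* con 1ℤ :* c :+ con 0ℤ))
      ≋-refl zS M (const (same (B 0) w)) α c₁)

  equation-T₁ : Equation-at (T 1)
  equation-T₁ rewrite same-T-off-base base 0 = ≋-modulo oneS
    (solve 6 (λ z m a b a₀ c →
        a :+ z :* con 1ℤ :* c
        := m :* con 0ℤ :+ z :* (b :+ con 1ℤ :* (c :- :- a) :+ (a₀ :+ con 0ℤ))
           :+ con 1ℤ :* (a :- z :* (a :+ b :+ a₀)))
      ≋-refl zS M α β a₀ c₁)
    hα

  equation-B₁ : Equation-at (B 1)
  equation-B₁ rewrite same-B-off-base base 0 =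
    ≋-modulo oneS (≋-modulo oneS (≋-modulo (⊖ e) identity z³q≋t) hB₁) hβ
    where
    e : Series
    e = (oneS ⊕ oneS ⊕ ⊖ t) ⊛ c₁ ⊕ ⊖ (⊖ α)
    identity = solve 8 (λ z t q m a b b₀ c →
        let one = con 1ℤ
            u   = one :- t
            e   = (one :+ one :- t) :* c :- :- a
        in b :+ one :* (c :- :- a)
           := m :* con 0ℤ :+ z :* (a :+ z :* (z :* one) :* (q :* e) :+ (b₀ :+ con 0ℤ))
              :+ one :* (b :- z :* (a :+ b :+ b₀))
              :+ one :* (u :* u :* c :+ z :* b :- :- (u :* a))
              :+ :- e :* (z :* z :* z :* q :- t))
      ≋-refl zS t q M α β b₀ c₁

  equation-T : ∀ j → Equation-at (T (suc (suc j)))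
  equation-T j rewrite same-T-off-base base (suc j) = ≋-modulo oneS
    (solve 8 (λ z p d₁ d₂ a b a₀ m →
        a :+ z :* (z :* p) :* d₂
        := m :* con 0ℤ :+ z :* (b :+ z :* p :* (d₂ :- d₁) :+ (a :+ z :* p :* d₁ :+ (a₀ :+ con 0ℤ)))
           :+ con 1ℤ :* (a :- z :* (a :+ b :+ a₀)))
      ≋-refl zS (zS^ j) (c (suc j)) (c (suc (suc j))) α β a₀ M)
    hα

  equation-B : ∀ j → Equation-at (B (suc (suc j)))
  equation-B j rewrite same-B-off-base base (suc j) =
    ≋-modulo oneS (≋-modulo (⊖ (zS ⊛ zS^ j)) identity (c-recurrence j)) hβ
    where
    identity = solve 10 (λ z p d₀ d₁ d₂ d₃ a b b₀ m →
        b :+ z :* p :* (d₂ :- d₁)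
        := m :* con 0ℤ :+ z :* (a :+ z :* (z :* (z :* p)) :* d₃ :+ (b :+ p :* (d₁ :- d₀) :+ (b₀ :+ con 0ℤ)))
           :+ con 1ℤ :* (b :- z :* (a :+ b :+ b₀))
           :+ :- (z :* p) :* (z :* z :* z :* d₃ :- (d₂ :+ :- (con 1ℤ :+ con 1ℤ) :* d₁ :+ d₀)))
      ≋-refl zS (zS^ j) (c j) (c (suc j)) (c (suc (suc j))) (c (suc (suc (suc j)))) α β b₀ M

  X-solves : Solves (λ v → M ⊛ const (same v w)) X
  X-solves = solves λ
    { (T zero)          → equation-T₀
    ; (T (suc zero))    → equation-T₁
    ; (T (suc (suc j))) → equation-T j
    ; (B zero)          → equation-B₀
    ; (B (suc zero))    → equation-B₁
    ; (B (suc (suc j))) → equation-B j }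

-- They solve the five boundary equations
-- of the ansatz exactly (by Cramer's rule, det being the determinant); kᵀ and kᴮ are the
-- cofactors by which a₀ · D - det · N is a multiple of z³ - t (1 - t)².
module Witnesses where

  z t u : Polynomial 2
  z = var zero
  t = var (suc zero)
  u = con 1ℤ :- t

  κ : ℕ → Polynomial 2
  κ n = con (ℤ.+ n)

  D Nᶠ Nᵍ relation : Polynomial 2
  D        = :- t :+ z :- z :* t :- z :* t :+ z :* t :* t
  Nᶠ       = :- t :+ z :- z :* t
  Nᵍ       = z :* (z :- t)
  relation = t :* u :* u :- z :* z :* z

  det : Polynomial 2
  det = u :* u :* (κ 1 :- κ 2 :* z :- κ 2 :* z :^ 3) :+ z :^ 4 :* (κ 2 :- t) :* (κ 2 :- t)
        :- z :^ 5 :* (κ 2 :- t) :+ z :^ 6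

  αᵀ βᵀ a₀ᵀ b₀ᵀ c₁ᵀ kᵀ : Polynomial 2
  αᵀ  = z :* u :* u :* (κ 1 :- z) :+ z :^ 5
  βᵀ  = z :^ 2 :* u :* u :* (κ 1 :+ z) :- z :^ 4 :* u
  a₀ᵀ = u :* u :* (κ 1 :- κ 2 :* z :- z :^ 3) :+ z :^ 4 :* (κ 2 :- t :- z)
  b₀ᵀ = z :^ 2 :* u :* u :- z :^ 3 :* u :* (κ 2 :- t) :+ z :^ 4 :* u :- z :^ 5
  c₁ᵀ = :- (z :* u :* (κ 1 :- z)) :- z :^ 3 :* (κ 1 :+ z)
  kᵀ  = z :* u :* (κ 1 :- κ 2 :* z) :+ z :^ 3 :- z :^ 4 :* u

  αᴮ βᴮ a₀ᴮ b₀ᴮ c₁ᴮ kᴮ : Polynomial 2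
  αᴮ  = z :^ 2 :* (κ 2 :- z) :* u :* u
  βᴮ  = z :* u :* u :* (κ 1 :- z :+ z :^ 2)
  a₀ᴮ = z :* u :* u :* (κ 1 :- κ 2 :* z)
  b₀ᴮ = u :* u :* (κ 1 :- κ 2 :* z)
  c₁ᴮ = :- (z :^ 2 :* (κ 3 :- κ 2 :* z :+ z :^ 2 :- t :* (κ 2 :- z)))
  kᴮ  = z :^ 2 :* (κ 2 :- t) :* (κ 1 :- κ 2 :* z) :+ z :^ 4 :* (κ 2 :- z)

module ClosedForms (t : Series) (t₀ : t 0 ≡ 0ℤ)
  (rel : t ⊛ (oneS ⊕ ⊖ t) ⊛ (oneS ⊕ ⊖ t) ≋ zS ⊛ zS ⊛ zS) where

  open Witnesses using (z; u; D; Nᶠ; Nᵍ; relation; det;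
                        αᵀ; βᵀ; a₀ᵀ; b₀ᵀ; c₁ᵀ; kᵀ; αᴮ; βᴮ; a₀ᴮ; b₀ᴮ; c₁ᴮ; kᴮ)
  open CubeFactor t t₀ rel using (q; z³q≋t; qu²≋1)

  ρ : Vec Series 2
  ρ = zS ∷ t ∷ []

  ⟪_⟫ : Polynomial 2 → Series
  ⟪ p ⟫ = ⟦ p ⟧ ρ

  det₀ : ⟪ det ⟫ 0 ≡ 1ℤ
  det₀ = ⟦⟧-coeff₀ det ρ (zS ∷ const 0ℤ ∷ []) λ { zero → refl ; (suc zero) → t₀ }

  module Towards-T₀ = Ansatz t q z³q≋t qu²≋1 T₀ ⟪ det ⟫ ⟪ αᵀ ⟫ ⟪ βᵀ ⟫ ⟪ a₀ᵀ ⟫ ⟪ b₀ᵀ ⟫ ⟪ c₁ᵀ ⟫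
    (prove ρ αᵀ (z :* (αᵀ :+ βᵀ :+ a₀ᵀ)) ≋-refl)
    (prove ρ βᵀ (z :* (αᵀ :+ βᵀ :+ b₀ᵀ)) ≋-refl)
    (prove ρ a₀ᵀ (det :* con 1ℤ :+ z :* b₀ᵀ) ≋-refl)
    (prove ρ b₀ᵀ (det :* con 0ℤ :+ z :* (αᵀ :+ z :* c₁ᵀ)) ≋-refl)
    (prove ρ (u :* u :* c₁ᵀ :+ z :* βᵀ) (:- (u :* αᵀ)) ≋-refl)

  module Towards-B₀ = Ansatz t q z³q≋t qu²≋1 B₀ ⟪ det ⟫ ⟪ αᴮ ⟫ ⟪ βᴮ ⟫ ⟪ a₀ᴮ ⟫ ⟪ b₀ᴮ ⟫ ⟪ c₁ᴮ ⟫
    (prove ρ αᴮ (z :* (αᴮ :+ βᴮ :+ a₀ᴮ)) ≋-refl)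
    (prove ρ βᴮ (z :* (αᴮ :+ βᴮ :+ b₀ᴮ)) ≋-refl)
    (prove ρ a₀ᴮ (det :* con 0ℤ :+ z :* b₀ᴮ) ≋-refl)
    (prove ρ b₀ᴮ (det :* con 1ℤ :+ z :* (αᴮ :+ z :* c₁ᴮ)) ≋-refl)
    (prove ρ (u :* u :* c₁ᴮ :+ z :* βᴮ) (:- (u :* αᴮ)) ≋-refl)

  f₀-closed-form : f 0 ⊛ (⊖ t ⊕ zS ⊕ ⊖ (zS ⊛ t) ⊕ ⊖ (zS ⊛ t) ⊕ zS ⊛ t ⊛ t) ≋ ⊖ t ⊕ zS ⊕ ⊖ (zS ⊛ t)
  f₀-closed-form = solve-for ⟪ det ⟫ (f 0) ⟪ a₀ᵀ ⟫ ⟪ D ⟫ ⟪ Nᶠ ⟫ det₀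
    (scaled-walkGF-unique (T 0) ⟪ det ⟫ Towards-T₀.X-solves (T 0))
    (≋-modulo ⟪ :- kᵀ ⟫ (prove ρ (a₀ᵀ :* D) (det :* Nᶠ :+ :- kᵀ :* relation) ≋-refl) rel)

  g₀-closed-form : g 0 ⊛ (⊖ t ⊕ zS ⊕ ⊖ (zS ⊛ t) ⊕ ⊖ (zS ⊛ t) ⊕ zS ⊛ t ⊛ t) ≋ zS ⊛ (zS ⊕ ⊖ t)
  g₀-closed-form = solve-for ⟪ det ⟫ (g 0) ⟪ a₀ᴮ ⟫ ⟪ D ⟫ ⟪ Nᵍ ⟫ det₀
    (scaled-walkGF-unique (B 0) ⟪ det ⟫ Towards-B₀.X-solves (T 0))
    (≋-modulo ⟪ :- kᴮ ⟫ (prove ρ (a₀ᴮ :* D) (det :* Nᵍ :+ :- kᴮ :* relation) ≋-refl) rel)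

mainTheorem1 : (t : Series) → t 0 ≡ 0ℤ
    → t ⊛ (oneS ⊕ ⊖ t) ⊛ (oneS ⊕ ⊖ t) ≋ zS ⊛ zS ⊛ zS
    → (f 0 ⊛ (⊖ t ⊕ zS ⊕ ⊖ (zS ⊛ t) ⊕ ⊖ (zS ⊛ t) ⊕ zS ⊛ t ⊛ t) ≋ (⊖ t ⊕ zS ⊕ ⊖ (zS ⊛ t)))
      × (g 0 ⊛ (⊖ t ⊕ zS ⊕ ⊖ (zS ⊛ t) ⊕ ⊖ (zS ⊛ t) ⊕ zS ⊛ t ⊛ t) ≋ zS ⊛ (zS ⊕ ⊖ t))
mainTheorem1 t t₀ rel = f₀-closed-form , g₀-closed-form
  where open ClosedForms t t₀ rel
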